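{- For every positive integer $n$, $\mathcal D'_{n+1}\le\mathcal D'_n+1$.
   Context: The stack-sorting map $s$ acts on permutations (orderings of finite sets of integers, in one-line notation): $s$ of the empty permutation is empty, and if $\pi=LmR$ with $m$ the largest entry, then $s(\pi)=s(L)s(R)m$; $s^t$ is its $t$-fold iterate. For a permutation $\pi$ with positive entries, $\pi0$ is the concatenation of $\pi$ with a new entry $0$, and $\operatorname{sd}'(\pi)$ is the smallest positive integer $t$ such that $0$ is the first entry of $s^t(\pi0)$. $S_n$ is the set of permutations of $[n]$, and $\mathcal D'_n=\frac1{n!}\sum_{\pi\in S_n}\operatorname{sd}'(\pi)$. -}

module Defs where

open import Data.Nat using (ℕ; zero; suc; _+_; _⊔_; _≡ᵇ_; _!)
open import Data.Nat.Properties using (_!≢0)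
open import Data.Bool using (Bool; true; false; if_then_else_)
open import Data.List using (List; []; _∷_; _++_; [_]; length; map; concatMap; foldr)
open import Data.Nat.ListAction using (sum)
open import Data.Product using (_×_; _,_)
open import Data.Integer using (+_)
open import Data.Rational using (ℚ; _/_)

-- Permutations are lists of distinct natural numbers (one-line notation).

-- largest entry of a list (0 for the empty list; entries are ≥ 0)
maxEntry : List ℕ → ℕ
maxEntry = foldr _⊔_ 0

splitAt : ℕ → List ℕ → List ℕ × List ℕ
splitAt m [] = [] , []
splitAt m (x ∷ xs) with m ≡ᵇ x
... | true  = [] , xs
... | false with splitAt m xs
...   | (L , R) = (x ∷ L) , R

-- stack-sorting map, s(∅) = ∅, s(L m R) = s(L) s(R) m, m the largest entry.
-- Written with a fuel argument for termination; fuel = length π suffices,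
-- since L and R are strictly shorter than π.
sFuel : ℕ → List ℕ → List ℕ
sFuel zero    π  = []
sFuel (suc f) [] = []
sFuel (suc f) π@(_ ∷ _) with splitAt (maxEntry π) π
... | (L , R) = sFuel f L ++ sFuel f R ++ [ maxEntry π ]

s : List ℕ → List ℕ
s π = sFuel (length π) π

headIsZero : List ℕ → Bool
headIsZero []      = false
headIsZero (x ∷ _) = x ≡ᵇ 0

-- search for the smallest t ≥ current with 0 first in s^t(σ₀);
-- argument σ is s^(t-1)(σ₀).  Bounded by fuel; returns 0 if not found
-- (never happens with the fuel used below).
sdSearch : ℕ → ℕ → List ℕ → ℕ
sdSearch zero     t σ = 0
sdSearch (suc f)  t σ with headIsZero (s σ)
... | true  = t
... | false = sdSearch f (suc t) (s σ)

-- sd'(π) : smallest positive t with 0 the first entry of s^t(π0).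
-- π0 has length |π|+1, and s^|π| sorts it, so fuel |π|+1 suffices.
sd' : List ℕ → ℕ
sd' π = sdSearch (suc (length π)) 1 (π ++ [ 0 ])

insertions : ℕ → List ℕ → List (List ℕ)
insertions x []       = (x ∷ []) ∷ []
insertions x (y ∷ ys) = (x ∷ y ∷ ys) ∷ map (y ∷_) (insertions x ys)

-- S n : the list of all n! permutations of [n] = {1,…,n}, each exactly once
S : ℕ → List (List ℕ)
S zero    = [] ∷ []
S (suc n) = concatMap (insertions (suc n)) (S n)

D' : ℕ → ℚ
D' n = (+ sum (map sd' (S n))) / (n !)
  where instance _ = n !≢0

module Submission where

-- Let π have positive entries and contain 1, and let π⁻ be π with the
-- entry 1 deleted.  Deleting the smallest positive entry x commutes with the
-- stack-sorting map on lists whose entries are 0 or ≥ x, and once 0 is the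
-- first entry of s^k(π⁻0) it is the first entry of s^(k+1)(π0).  Hence
--   sd'(π) ≤ sd'(π⁻) + 1.                                       (★)
-- Every σ ∈ S_n arises as π⁻ (after relabelling 2,…,n+1 ↦ 1,…,n, which does
-- not change sd') from exactly n+1 permutations π ∈ S_{n+1}, namely the ways
-- of inserting 1.  Summing (★) over these gives
--   Σ_{S_{n+1}} sd' ≤ (n+1)·(Σ_{S_n} sd' + n!),
-- and dividing by (n+1)! is the claim.

module SortingDepth where

  open import Defs
  open import Data.Nat
    using (ℕ; zero; suc; _+_; _*_; _≤_; _<_; _⊔_; _≡ᵇ_; _≟_; _!; z≤n; s≤s)
  open import Data.Nat.Properties
  open import Data.Bool using (true; false)
  open import Data.Sum using (_⊎_; inj₁; inj₂)
  open import Data.Product using (∃; ∃₂; _×_; _,_; proj₁; proj₂)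
  open import Data.List using (List; []; _∷_; _++_; [_]; length; map; concatMap; filter)
  open import Data.List.Properties
    using (∷-injectiveˡ; ++-assoc; length-++; length-map; map-++; map-∘; concatMap-++; concatMap-map;
           filter-++; filter-accept; filter-reject; filter-all; filter-notAll; length-filter)
  open import Data.List.Relation.Unary.All as All using (All; []; _∷_)
  import Data.List.Relation.Unary.All.Properties as All
  open import Data.List.Relation.Unary.Any as Any using (here; there; tail)
  open import Data.List.Membership.Propositional using (_∈_)
  open import Data.List.Membership.Propositional.Properties using (∈-filter⁺)
  open import Data.List.Relation.Binary.Permutation.Propositional as ↭
    using (_↭_; ↭-sym; ↭-trans; ↭-refl; ↭-reflexive)
  open import Data.List.Relation.Binary.Permutation.Propositional.Properties
    using (++⁺; ++⁺ˡ; ++-comm; shifts; map⁺; ↭-length; All-resp-↭; filter-↭)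
  open import Data.Nat.ListAction using (sum)
  open import Data.Nat.ListAction.Properties using (sum-++; sum-↭)
  open import Data.List.Extrema.Nat using (min; min≤⊤; min≤xs; argmin-sel)
  open import Function using (_∘_; id)
  open import Relation.Nullary using (¬?; yes; no; contradiction)
  open import Relation.Binary.PropositionalEquality hiding ([_])
  open ≡-Reasoning

  ≡ᵇ-refl : ∀ m → (m ≡ᵇ m) ≡ true
  ≡ᵇ-refl zero    = refl
  ≡ᵇ-refl (suc m) = ≡ᵇ-refl m

  ≡ᵇ-false : ∀ {m n} → m ≢ n → (m ≡ᵇ n) ≡ false
  ≡ᵇ-false {zero}  {zero}  m≢n = contradiction refl m≢n
  ≡ᵇ-false {zero}  {suc n} _   = refl
  ≡ᵇ-false {suc m} {zero}  _   = refl
  ≡ᵇ-false {suc m} {suc n} m≢n = ≡ᵇ-false (m≢n ∘ cong suc)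

  left right : ℕ → List ℕ → List ℕ
  left m xs = proj₁ (splitAt m xs)
  right m xs = proj₂ (splitAt m xs)

  splitAt-here : ∀ {m x} xs → m ≡ x → splitAt m (x ∷ xs) ≡ ([] , xs)
  splitAt-here {m} xs refl rewrite ≡ᵇ-refl m = refl

  splitAt-there : ∀ {m x} xs → m ≢ x → splitAt m (x ∷ xs) ≡ (x ∷ left m xs , right m xs)
  splitAt-there xs m≢x rewrite ≡ᵇ-false m≢x = refl

  splitAt-∈ : ∀ {m xs} → m ∈ xs → xs ≡ left m xs ++ m ∷ right m xs
  splitAt-∈ {m} {x ∷ xs} m∈ with m ≟ x
  ... | yes refl = cong (λ p → proj₁ p ++ m ∷ proj₂ p) (sym (splitAt-here {m} xs refl))
  ... | no m≢x   = begin
    x ∷ xs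
      ≡⟨ cong (x ∷_) (splitAt-∈ (tail m≢x m∈)) ⟩
    x ∷ left m xs ++ m ∷ right m xs
      ≡⟨ cong (λ p → proj₁ p ++ m ∷ proj₂ p) (splitAt-there xs m≢x) ⟨
    left m (x ∷ xs) ++ m ∷ right m (x ∷ xs) ∎

  splitAt-skip : ∀ {m} ys zs → All (m ≢_) ys → splitAt m (ys ++ zs) ≡ (ys ++ left m zs , right m zs)
  splitAt-skip []       zs []           = refl
  splitAt-skip (y ∷ ys) zs (m≢y ∷ m∉ys) = begin
    splitAt _ (y ∷ ys ++ zs)
      ≡⟨ splitAt-there (ys ++ zs) m≢y ⟩
    (y ∷ left _ (ys ++ zs) , right _ (ys ++ zs))
      ≡⟨ cong (λ p → y ∷ proj₁ p , proj₂ p) (splitAt-skip ys zs m∉ys) ⟩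
    (y ∷ ys ++ left _ zs , right _ zs) ∎

  maxEntry-ub : ∀ xs → All (_≤ maxEntry xs) xs
  maxEntry-ub []       = []
  maxEntry-ub (x ∷ xs) = m≤m⊔n x _ ∷ All.map (λ y≤ → ≤-trans y≤ (m≤n⊔m x _)) (maxEntry-ub xs)

  maxEntry-lub : ∀ {k} xs → All (_≤ k) xs → maxEntry xs ≤ k
  maxEntry-lub []       []         = z≤n
  maxEntry-lub (x ∷ xs) (x≤ ∷ xs≤) = ⊔-lub x≤ (maxEntry-lub xs xs≤)

  maxEntry-∈ : ∀ x xs → maxEntry (x ∷ xs) ∈ x ∷ xs
  maxEntry-∈ x []       = here (⊔-identityʳ x)
  maxEntry-∈ x (y ∷ ys) with ⊔-sel x (maxEntry (y ∷ ys))
  ... | inj₁ e = here e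
  ... | inj₂ e = there (subst (_∈ y ∷ ys) (sym e) (maxEntry-∈ y ys))

  lhs rhs : List ℕ → List ℕ
  lhs xs = left (maxEntry xs) xs
  rhs xs = right (maxEntry xs) xs

  decompose : ∀ x xs → x ∷ xs ≡ lhs (x ∷ xs) ++ maxEntry (x ∷ xs) ∷ rhs (x ∷ xs)
  decompose x xs = splitAt-∈ (maxEntry-∈ x xs)

  decompose-length : ∀ x xs → length (lhs (x ∷ xs)) + length (rhs (x ∷ xs)) ≡ length xs
  decompose-length x xs = suc-injective (begin
    suc (length L + length R)   ≡⟨ +-suc (length L) (length R) ⟨
    length L + length (M ∷ R)   ≡⟨ length-++ L ⟨
    length (L ++ M ∷ R)         ≡⟨ cong length (decompose x xs) ⟨
    suc (length xs)             ∎)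
    where
    L = lhs (x ∷ xs)
    R = rhs (x ∷ xs)
    M = maxEntry (x ∷ xs)

  lhs-fuel : ∀ {f} x xs → length (x ∷ xs) ≤ suc f → length (lhs (x ∷ xs)) ≤ f
  lhs-fuel x xs (s≤s l) = ≤-trans (m+n≤o⇒m≤o _ (≤-reflexive (decompose-length x xs))) l

  rhs-fuel : ∀ {f} x xs → length (x ∷ xs) ≤ suc f → length (rhs (x ∷ xs)) ≤ f
  rhs-fuel x xs (s≤s l) = ≤-trans (m+n≤o⇒n≤o _ (≤-reflexive (decompose-length x xs))) l

  sFuel-[] : ∀ f → sFuel f [] ≡ []
  sFuel-[] zero    = refl
  sFuel-[] (suc f) = refl

  -- One round of s on any nonempty list (given by one of its members).
  sFuel-unfold : ∀ f {m} ws → m ∈ ws →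
                 sFuel (suc f) ws ≡ sFuel f (lhs ws) ++ sFuel f (rhs ws) ++ [ maxEntry ws ]
  sFuel-unfold f (w ∷ ws) _ = refl

  sFuel-fuel : ∀ f g xs → length xs ≤ f → length xs ≤ g → sFuel f xs ≡ sFuel g xs
  sFuel-fuel f       g       []       _  _  = trans (sFuel-[] f) (sym (sFuel-[] g))
  sFuel-fuel (suc f) (suc g) (x ∷ xs) lf lg =
    cong₂ (λ a b → a ++ b ++ [ maxEntry (x ∷ xs) ])
      (sFuel-fuel f g (lhs (x ∷ xs)) (lhs-fuel x xs lf) (lhs-fuel x xs lg))
      (sFuel-fuel f g (rhs (x ∷ xs)) (rhs-fuel x xs lf) (rhs-fuel x xs lg))

  sFuel-↭ : ∀ f xs → length xs ≤ f → sFuel f xs ↭ xs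
  sFuel-↭ f       []       _ = ↭-reflexive (sFuel-[] f)
  sFuel-↭ (suc f) (x ∷ xs) l = ↭-trans
    (++⁺ (sFuel-↭ f L (lhs-fuel x xs l)) (++⁺ (sFuel-↭ f R (rhs-fuel x xs l)) ↭-refl))
    (↭-trans (++⁺ˡ L (++-comm R [ M ])) (↭-reflexive (sym (decompose x xs))))
    where
    L = lhs (x ∷ xs)
    R = rhs (x ∷ xs)
    M = maxEntry (x ∷ xs)

  s-↭ : ∀ xs → s xs ↭ xs
  s-↭ xs = sFuel-↭ (length xs) xs ≤-refl

  ↭-constant : ∀ {c} {ys zs : List ℕ} → ys ↭ zs → All (_≡ c) zs → ys ≡ zs
  ↭-constant p zs≡c = equal (All-resp-↭ (↭-sym p) zs≡c) zs≡c (↭-length p)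
    where
    equal : ∀ {c} {ys zs : List ℕ} → All (_≡ c) ys → All (_≡ c) zs → length ys ≡ length zs → ys ≡ zs
    equal []         []         _  = refl
    equal (refl ∷ a) (refl ∷ b) eq = cong (_ ∷_) (equal a b (suc-injective eq))

  s^ : ℕ → List ℕ → List ℕ
  s^ zero    σ = σ
  s^ (suc k) σ = s (s^ k σ)

  s^-shift : ∀ k σ → s^ (suc k) σ ≡ s^ k (s σ)
  s^-shift zero    σ = refl
  s^-shift (suc k) σ = cong s (s^-shift k σ)

  remove : ℕ → List ℕ → List ℕ
  remove x = filter (λ y → ¬? (x ≟ y))

  remove-here : ∀ {x y} ys → x ≡ y → remove x (y ∷ ys) ≡ remove x ys
  remove-here {x} _ x≡y = filter-reject (λ y → ¬? (x ≟ y)) (λ x≢y → x≢y x≡y)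

  remove-there : ∀ {x y} ys → x ≢ y → remove x (y ∷ ys) ≡ y ∷ remove x ys
  remove-there {x} _ = filter-accept (λ y → ¬? (x ≟ y))

  remove-++ : ∀ x xs ys → remove x (xs ++ ys) ≡ remove x xs ++ remove x ys
  remove-++ x = filter-++ (λ y → ¬? (x ≟ y))

  remove-length : ∀ x xs → length (remove x xs) ≤ length xs
  remove-length x = length-filter (λ y → ¬? (x ≟ y))

  remove-shorter : ∀ {x xs} → x ∈ xs → length (remove x xs) < length xs
  remove-shorter {x} {xs} x∈ =
    filter-notAll (λ y → ¬? (x ≟ y)) xs (Any.map (λ x≡y x≢y → x≢y x≡y) x∈)

  remove-All : ∀ {P : ℕ → Set} x {xs} → All P xs → All P (remove x xs)
  remove-All x = All.filter⁺ (λ y → ¬? (x ≟ y))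

  remove-absent : ∀ {x xs} → All (x ≢_) xs → remove x xs ≡ xs
  remove-absent {x} = filter-all (λ y → ¬? (x ≟ y))

  maxEntry-remove : ∀ {x} xs → x ≢ maxEntry xs → maxEntry (remove x xs) ≡ maxEntry xs
  maxEntry-remove []       _   = refl
  maxEntry-remove {x} (y ∷ ys) x≢M = ≤-antisym
    (maxEntry-lub (remove x (y ∷ ys)) (remove-All x (maxEntry-ub (y ∷ ys))))
    (All.lookup (maxEntry-ub (remove x (y ∷ ys))) (∈-filter⁺ (λ z → ¬? (x ≟ z)) (maxEntry-∈ y ys) x≢M))

  splitAt-remove : ∀ {x m} xs → x ≢ m →
                   splitAt m (remove x xs) ≡ (remove x (left m xs) , remove x (right m xs))
  splitAt-remove [] _ = refl
  splitAt-remove {x} {m} (y ∷ ys) x≢m with x ≟ y | m ≟ y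
  ... | yes x≡y | yes m≡y = contradiction (trans x≡y (sym m≡y)) x≢m
  ... | yes x≡y | no m≢y  = begin
    splitAt m (remove x (y ∷ ys))                   ≡⟨ cong (splitAt m) (remove-here ys x≡y) ⟩
    splitAt m (remove x ys)                         ≡⟨ splitAt-remove ys x≢m ⟩
    (remove x (left m ys) , remove x (right m ys))  ≡⟨ cong (_, _) (remove-here (left m ys) x≡y) ⟨
    (remove x (y ∷ left m ys) , remove x (right m ys))
      ≡⟨ cong (λ p → remove x (proj₁ p) , remove x (proj₂ p)) (splitAt-there ys m≢y) ⟨
    (remove x (left m (y ∷ ys)) , remove x (right m (y ∷ ys))) ∎
  ... | no x≢y  | yes m≡y = begin
    splitAt m (remove x (y ∷ ys))  ≡⟨ cong (splitAt m) (remove-there ys x≢y) ⟩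
    splitAt m (y ∷ remove x ys)    ≡⟨ splitAt-here (remove x ys) m≡y ⟩
    ([] , remove x ys)
      ≡⟨ cong (λ p → remove x (proj₁ p) , remove x (proj₂ p)) (splitAt-here ys m≡y) ⟨
    (remove x (left m (y ∷ ys)) , remove x (right m (y ∷ ys))) ∎
  ... | no x≢y  | no m≢y  = begin
    splitAt m (remove x (y ∷ ys))  ≡⟨ cong (splitAt m) (remove-there ys x≢y) ⟩
    splitAt m (y ∷ remove x ys)    ≡⟨ splitAt-there (remove x ys) m≢y ⟩
    (y ∷ left m (remove x ys) , right m (remove x ys))
      ≡⟨ cong (λ p → y ∷ proj₁ p , proj₂ p) (splitAt-remove ys x≢m) ⟩
    (y ∷ remove x (left m ys) , remove x (right m ys))
      ≡⟨ cong (_, _) (remove-there (left m ys) x≢y) ⟨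
    (remove x (y ∷ left m ys) , remove x (right m ys))
      ≡⟨ cong (λ p → remove x (proj₁ p) , remove x (proj₂ p)) (splitAt-there ys m≢y) ⟨
    (remove x (left m (y ∷ ys)) , remove x (right m (y ∷ ys))) ∎

  -- y is 0 or at least x: on lists of such entries, x is the least positive value.
  ZeroOrAbove : ℕ → ℕ → Set
  ZeroOrAbove x y = y ≡ 0 ⊎ x ≤ y

  remove-top : ∀ {x} xs → All (_≤ x) xs → All (ZeroOrAbove x) xs → All (_≡ 0) (remove x xs)
  remove-top {x} xs ≤x above = All.zipWith zero-left
    (All.all-filter (λ y → ¬? (x ≟ y)) xs , remove-All x (All.zip (≤x , above)))
    where
    zero-left : ∀ {y} → x ≢ y × (y ≤ x × ZeroOrAbove x y) → y ≡ 0
    zero-left (_   , _   , inj₁ y≡0) = y≡0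
    zero-left (x≢y , y≤x , inj₂ x≤y) = contradiction (≤-antisym x≤y y≤x) x≢y

  sFuel-remove-unfold : ∀ {x} f y ys → x ≢ maxEntry (y ∷ ys) →
    sFuel (suc f) (remove x (y ∷ ys)) ≡
      sFuel f (remove x (lhs (y ∷ ys))) ++ sFuel f (remove x (rhs (y ∷ ys))) ++ [ maxEntry (y ∷ ys) ]
  sFuel-remove-unfold {x} f y ys x≢M = begin
    sFuel (suc f) ws
      ≡⟨ sFuel-unfold f ws (∈-filter⁺ (λ z → ¬? (x ≟ z)) (maxEntry-∈ y ys) x≢M) ⟩
    sFuel f (lhs ws) ++ sFuel f (rhs ws) ++ [ maxEntry ws ]
      ≡⟨ cong (λ m → sFuel f (left m ws) ++ sFuel f (right m ws) ++ [ m ]) (maxEntry-remove (y ∷ ys) x≢M) ⟩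
    sFuel f (left M ws) ++ sFuel f (right M ws) ++ [ M ]
      ≡⟨ cong (λ p → sFuel f (proj₁ p) ++ sFuel f (proj₂ p) ++ [ M ]) (splitAt-remove (y ∷ ys) x≢M) ⟩
    sFuel f (remove x (lhs (y ∷ ys))) ++ sFuel f (remove x (rhs (y ∷ ys))) ++ [ M ] ∎
    where
    M = maxEntry (y ∷ ys)
    ws = remove x (y ∷ ys)

  -- If x is the maximum, both sides are rearrangements of the
  -- all-zero list remove x xs; otherwise recurse into the two parts.
  remove-sFuel : ∀ {x} f xs → All (ZeroOrAbove x) xs → length xs ≤ f →
                 remove x (sFuel f xs) ≡ sFuel f (remove x xs)
  remove-sFuel {x} f [] _ _ = begin
    remove x (sFuel f [])  ≡⟨ cong (remove x) (sFuel-[] f) ⟩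
    []                     ≡⟨ sFuel-[] f ⟨
    sFuel f []             ∎
  remove-sFuel {x} (suc f) (y ∷ ys) above l with x ≟ maxEntry (y ∷ ys)
  ... | yes refl = begin
    remove x (sFuel (suc f) (y ∷ ys))
      ≡⟨ ↭-constant (filter-↭ (λ z → ¬? (x ≟ z)) (sFuel-↭ (suc f) (y ∷ ys) l)) zeros ⟩
    remove x (y ∷ ys)
      ≡⟨ ↭-constant (sFuel-↭ (suc f) _ (≤-trans (remove-length x (y ∷ ys)) l)) zeros ⟨
    sFuel (suc f) (remove x (y ∷ ys)) ∎
    where
    zeros = remove-top (y ∷ ys) (maxEntry-ub (y ∷ ys)) above
  ... | no x≢M = begin
    remove x (sFuel f L ++ sFuel f R ++ [ M ])
      ≡⟨ remove-++ x (sFuel f L) _ ⟩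
    remove x (sFuel f L) ++ remove x (sFuel f R ++ [ M ])
      ≡⟨ cong (remove x (sFuel f L) ++_) (remove-++ x (sFuel f R) [ M ]) ⟩
    remove x (sFuel f L) ++ remove x (sFuel f R) ++ remove x [ M ]
      ≡⟨ cong₂ (λ a b → a ++ b ++ remove x [ M ])
           (remove-sFuel f L (proj₁ parts) (lhs-fuel y ys l))
           (remove-sFuel f R (All.tail (proj₂ parts)) (rhs-fuel y ys l)) ⟩
    sFuel f (remove x L) ++ sFuel f (remove x R) ++ remove x [ M ]
      ≡⟨ cong (λ a → sFuel f (remove x L) ++ sFuel f (remove x R) ++ a) (remove-there [] x≢M) ⟩
    sFuel f (remove x L) ++ sFuel f (remove x R) ++ [ M ]
      ≡⟨ sFuel-remove-unfold f y ys x≢M ⟨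
    sFuel (suc f) (remove x (y ∷ ys)) ∎
    where
    L = lhs (y ∷ ys)
    R = rhs (y ∷ ys)
    M = maxEntry (y ∷ ys)
    parts : All (ZeroOrAbove x) L × All (ZeroOrAbove x) (M ∷ R)
    parts = All.++⁻ L (subst (All (ZeroOrAbove x)) (decompose y ys) above)

  remove-s : ∀ {x} σ → All (ZeroOrAbove x) σ → remove x (s σ) ≡ s (remove x σ)
  remove-s {x} σ above = begin
    remove x (s σ)                 ≡⟨ remove-sFuel (length σ) σ above ≤-refl ⟩
    sFuel (length σ) (remove x σ)  ≡⟨ sFuel-fuel _ _ (remove x σ) (remove-length x σ) ≤-refl ⟩
    s (remove x σ)                 ∎

  -- s only rearranges entries, so removal commutes with every iterate.
  ZeroOrAbove-s^ : ∀ {x} k σ → All (ZeroOrAbove x) σ → All (ZeroOrAbove x) (s^ k σ)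
  ZeroOrAbove-s^ zero    σ above = above
  ZeroOrAbove-s^ (suc k) σ above = All-resp-↭ (↭-sym (s-↭ (s^ k σ))) (ZeroOrAbove-s^ k σ above)

  remove-s^ : ∀ {x} k σ → All (ZeroOrAbove x) σ → remove x (s^ k σ) ≡ s^ k (remove x σ)
  remove-s^ zero    σ _     = refl
  remove-s^ (suc k) σ above =
    trans (remove-s (s^ k σ) (ZeroOrAbove-s^ k σ above)) (cong s (remove-s^ k σ above))

  StartsWithZero : List ℕ → Set
  StartsWithZero τ = ∃ λ t → τ ≡ 0 ∷ t

  startsWithZero-++ : ∀ {a} b → StartsWithZero a → StartsWithZero (a ++ b)
  startsWithZero-++ b (t , refl) = t ++ b , refl

  zero-first-via-lhs : ∀ f x xs → StartsWithZero (sFuel f (lhs (x ∷ xs))) →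
                       StartsWithZero (sFuel (suc f) (x ∷ xs))
  zero-first-via-lhs f x xs = startsWithZero-++ _

  zero-first-via-rhs : ∀ f x xs → lhs (x ∷ xs) ≡ [] → StartsWithZero (sFuel f (rhs (x ∷ xs))) →
                       StartsWithZero (sFuel (suc f) (x ∷ xs))
  zero-first-via-rhs f x xs L≡[] z =
    subst (λ a → StartsWithZero (sFuel f a ++ sFuel f (rhs (x ∷ xs)) ++ [ maxEntry (x ∷ xs) ])) (sym L≡[])
      (subst (λ a → StartsWithZero (a ++ sFuel f (rhs (x ∷ xs)) ++ [ maxEntry (x ∷ xs) ])) (sym (sFuel-[] f))
        (startsWithZero-++ [ maxEntry (x ∷ xs) ] z))

  -- A leading 0 stays first: either all entries are 0, or the maximum lies to
  -- its right and 0 starts lhs.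
  zero-stays-first : ∀ f X → length (0 ∷ X) ≤ f → StartsWithZero (sFuel f (0 ∷ X))
  zero-stays-first (suc f) X l with maxEntry X ≟ 0
  ... | yes M≡0 =
    X , ↭-constant (sFuel-↭ (suc f) (0 ∷ X) l) (refl ∷ All.map (n≤0⇒n≡0 ∘ ≤M⇒≤0) (maxEntry-ub X))
    where
    ≤M⇒≤0 : ∀ {y} → y ≤ maxEntry X → y ≤ 0
    ≤M⇒≤0 = subst (_ ≤_) M≡0
  ... | no M≢0  =
    zero-first-via-lhs f 0 X (subst (StartsWithZero ∘ sFuel f) lhs≡ (zero-stays-first f (left M X) l'))
    where
    M = maxEntry X
    lhs≡ : 0 ∷ left M X ≡ lhs (0 ∷ X)
    lhs≡ = cong proj₁ (sym (splitAt-there X M≢0))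
    l' : length (0 ∷ left M X) ≤ f
    l' = subst (λ w → length w ≤ f) (sym lhs≡) (lhs-fuel 0 X l)

  -- If copies of a positive x precede the first 0, one round puts 0 first:
  -- a copy of x that is the maximum is sent behind the 0, a larger maximum lies
  -- right of the 0 and leaves the same shape in lhs.
  copies-then-zero : ∀ f {x} P X → 0 < x → All (_≡ x) P → length (P ++ 0 ∷ X) ≤ f →
                     StartsWithZero (sFuel f (P ++ 0 ∷ X))
  copies-then-zero f [] X _ [] l = zero-stays-first f X l
  copies-then-zero (suc f) {x} (.x ∷ P) X 0<x (refl ∷ copies) l with maxEntry (x ∷ P ++ 0 ∷ X) ≟ x
  ... | yes M≡x = zero-first-via-rhs f x (P ++ 0 ∷ X) (cong proj₁ split)
      (subst (StartsWithZero ∘ sFuel f) (sym (cong proj₂ split)) (copies-then-zero f P X 0<x copies l'))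
    where
    split = splitAt-here (P ++ 0 ∷ X) M≡x
    l' : length (P ++ 0 ∷ X) ≤ f
    l' = subst (λ w → length w ≤ f) (cong proj₂ split) (rhs-fuel x (P ++ 0 ∷ X) l)
  ... | no M≢x = zero-first-via-lhs f x (P ++ 0 ∷ X)
      (subst (StartsWithZero ∘ sFuel f) (sym lhs≡) (copies-then-zero f (x ∷ P) (left M X) 0<x (refl ∷ copies) l'))
    where
    M = maxEntry (x ∷ P ++ 0 ∷ X)
    M≢0 : M ≢ 0
    M≢0 M≡0 = <⇒≢ 0<x (sym (n≤0⇒n≡0 (subst (x ≤_) M≡0 (All.head (maxEntry-ub (x ∷ P ++ 0 ∷ X))))))
    skip : All (M ≢_) ((x ∷ P) ++ [ 0 ])
    skip = All.++⁺ (All.map (λ y≡x M≡y → M≢x (trans M≡y y≡x)) (refl ∷ copies)) (M≢0 ∷ [])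
    lhs≡ : lhs (x ∷ P ++ 0 ∷ X) ≡ (x ∷ P) ++ 0 ∷ left M X
    lhs≡ = begin
      left M ((x ∷ P) ++ 0 ∷ X)        ≡⟨ cong (left M) (++-assoc (x ∷ P) [ 0 ] X) ⟨
      left M (((x ∷ P) ++ [ 0 ]) ++ X)  ≡⟨ cong proj₁ (splitAt-skip ((x ∷ P) ++ [ 0 ]) X skip) ⟩
      ((x ∷ P) ++ [ 0 ]) ++ left M X    ≡⟨ ++-assoc (x ∷ P) [ 0 ] (left M X) ⟩
      (x ∷ P) ++ 0 ∷ left M X           ∎
    l' : length ((x ∷ P) ++ 0 ∷ left M X) ≤ f
    l' = subst (λ w → length w ≤ f) lhs≡ (lhs-fuel x (P ++ 0 ∷ X) l)

  removed-prefix : ∀ {x w} τ → remove x τ ≡ 0 ∷ w → ∃₂ λ P X → τ ≡ P ++ 0 ∷ X × All (_≡ x) P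
  removed-prefix {x} (y ∷ ys) e with x ≟ y
  ... | yes x≡y =
    let P , X , ys≡ , copies = removed-prefix ys (trans (sym (remove-here ys x≡y)) e)
    in y ∷ P , X , cong (y ∷_) ys≡ , sym x≡y ∷ copies
  ... | no x≢y = [] , ys , cong (_∷ ys) (∷-injectiveˡ (trans (sym (remove-there ys x≢y)) e)) , []

  zero-first-after-removal : ∀ {x} τ → 0 < x → StartsWithZero (remove x τ) → StartsWithZero (s τ)
  zero-first-after-removal τ 0<x (w , e) with removed-prefix τ e
  ... | P , X , refl , copies = copies-then-zero (length (P ++ 0 ∷ X)) P X 0<x copies ≤-refl

  zero-first-delay : ∀ {x} k σ → 0 < x → All (ZeroOrAbove x) σ →
                     StartsWithZero (s^ k (remove x σ)) → StartsWithZero (s^ (suc k) σ)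
  zero-first-delay k σ 0<x above z =
    zero-first-after-removal (s^ k σ) 0<x (subst StartsWithZero (sym (remove-s^ k σ above)) z)

  headIsZero-complete : ∀ {τ} → StartsWithZero τ → headIsZero τ ≡ true
  headIsZero-complete (t , refl) = refl

  headIsZero-sound : ∀ τ → headIsZero τ ≡ true → StartsWithZero τ
  headIsZero-sound (zero ∷ ys) _ = ys , refl

  sdSearch-hit : ∀ f t σ → headIsZero (s σ) ≡ true → sdSearch (suc f) t σ ≡ t
  sdSearch-hit f t σ e rewrite e = refl

  sdSearch-finds : ∀ f t σ k → k < f → StartsWithZero (s^ (suc k) σ) →
                   ∃ λ j → j ≤ k × sdSearch f t σ ≡ t + j × StartsWithZero (s^ (suc j) σ)
  sdSearch-finds (suc f) t σ zero _ z =
    0 , z≤n , trans (sdSearch-hit f t σ (headIsZero-complete z)) (sym (+-identityʳ t)) , z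
  sdSearch-finds (suc f) t σ (suc k) (s≤s k<f) z with headIsZero (s σ) in e
  ... | true  = 0 , z≤n , sym (+-identityʳ t) , headIsZero-sound (s σ) e
  ... | false =
    let j , j≤k , found , zj = sdSearch-finds f (suc t) (s σ) k k<f (subst StartsWithZero (s^-shift (suc k) σ) z)
    in suc j , s≤s j≤k , trans found (sym (+-suc t j)) ,
       subst StartsWithZero (sym (s^-shift (suc j) σ)) zj

  sd'-least : ∀ π k → k ≤ length π → StartsWithZero (s^ (suc k) (π ++ [ 0 ])) → sd' π ≤ suc k
  sd'-least π k k≤ z with sdSearch-finds (suc (length π)) 1 (π ++ [ 0 ]) k (s≤s k≤) z
  ... | j , j≤k , found , _ = subst (_≤ suc k) (sym found) (s≤s j≤k)

  min-∈ : ∀ y ys → min y ys ∈ y ∷ ys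
  min-∈ y ys with argmin-sel id y ys
  ... | inj₁ min≡y  = here min≡y
  ... | inj₂ min∈ys = there min∈ys

  min-least : ∀ y ys → All (min y ys ≤_) (y ∷ ys)
  min-least y ys = min≤⊤ y ys ∷ min≤xs y ys

  remove-snoc-zero : ∀ {x} π → 0 < x → remove x (π ++ [ 0 ]) ≡ remove x π ++ [ 0 ]
  remove-snoc-zero {x} π 0<x =
    trans (remove-++ x π [ 0 ]) (cong (remove x π ++_) (remove-there [] (<⇒≢ 0<x ∘ sym)))

  zeroOrAbove-snoc : ∀ {x π} → All (x ≤_) π → All (ZeroOrAbove x) (π ++ [ 0 ])
  zeroOrAbove-snoc x≤π = All.++⁺ (All.map inj₂ x≤π) (inj₁ refl ∷ [])

  -- If π has positive entries then 0 is first in s^(k+1)(π0) for some k ≤ |π|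
  -- (so the search defining sd' succeeds): delete the least entry and induct.
  zero-reaches-front : ∀ π → All (0 <_) π →
                       ∃ λ k → k ≤ length π × StartsWithZero (s^ (suc k) (π ++ [ 0 ]))
  zero-reaches-front π = reach (length π) π ≤-refl
    where
    reach : ∀ n π → length π ≤ n → All (0 <_) π →
            ∃ λ k → k ≤ length π × StartsWithZero (s^ (suc k) (π ++ [ 0 ]))
    reach _       []       _       _   = 0 , z≤n , [] , refl
    reach (suc n) (y ∷ ys) (s≤s l) pos =
      let k , k≤ , z = reach n (remove x (y ∷ ys)) shorter (remove-All x pos)
      in suc k , ≤-trans (s≤s k≤) (remove-shorter (min-∈ y ys)) ,
         zero-first-delay (suc k) ((y ∷ ys) ++ [ 0 ]) 0<x (zeroOrAbove-snoc (min-least y ys))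
           (subst (StartsWithZero ∘ s^ (suc k)) (sym (remove-snoc-zero (y ∷ ys) 0<x)) z)
      where
      x = min y ys
      0<x : 0 < x
      0<x = All.lookup pos (min-∈ y ys)
      shorter : length (remove x (y ∷ ys)) ≤ n
      shorter = ≤-trans (≤-pred (remove-shorter (min-∈ y ys))) l

  sd'-attained : ∀ π → All (0 <_) π →
                 ∃ λ j → j ≤ length π × sd' π ≡ suc j × StartsWithZero (s^ (suc j) (π ++ [ 0 ]))
  sd'-attained π pos with zero-reaches-front π pos
  ... | k , k≤ , z with sdSearch-finds (suc (length π)) 1 (π ++ [ 0 ]) k (s≤s k≤) z
  ...   | j , j≤k , found , zj = j , ≤-trans j≤k k≤ , found , zj

  sd'-remove-one : ∀ π → All (0 <_) π → 1 ∈ π → sd' π ≤ suc (sd' (remove 1 π))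
  sd'-remove-one π pos 1∈π with sd'-attained (remove 1 π) (remove-All 1 pos)
  ... | j , j≤ , sd'≡ , z = subst (λ d → sd' π ≤ suc d) (sym sd'≡)
    (sd'-least π (suc j) (≤-trans (s≤s j≤) (remove-shorter 1∈π))
      (zero-first-delay (suc j) (π ++ [ 0 ]) (s≤s z≤n) (zeroOrAbove-snoc pos)
        (subst (StartsWithZero ∘ s^ (suc j)) (sym (remove-snoc-zero π (s≤s z≤n))) z)))

  -- A relabelling f of the values that fixes 0, is injective and commutes
  -- with ⊔ (any strictly increasing f with f 0 ≡ 0) commutes with s, and
  -- hence does not change sd'.
  module Relabel (f : ℕ → ℕ) (f-0 : f 0 ≡ 0) (f-injective : ∀ {a b} → f a ≡ f b → a ≡ b)
                 (f-⊔ : ∀ a b → f (a ⊔ b) ≡ f a ⊔ f b) where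

    maxEntry-map : ∀ xs → maxEntry (map f xs) ≡ f (maxEntry xs)
    maxEntry-map []       = sym f-0
    maxEntry-map (x ∷ xs) = trans (cong (f x ⊔_) (maxEntry-map xs)) (sym (f-⊔ x (maxEntry xs)))

    splitAt-map : ∀ m xs → splitAt (f m) (map f xs) ≡ (map f (left m xs) , map f (right m xs))
    splitAt-map m []       = refl
    splitAt-map m (y ∷ ys) with m ≟ y
    ... | yes m≡y = begin
      splitAt (f m) (f y ∷ map f ys)
        ≡⟨ splitAt-here (map f ys) (cong f m≡y) ⟩
      ([] , map f ys)
        ≡⟨ cong (λ p → map f (proj₁ p) , map f (proj₂ p)) (splitAt-here ys m≡y) ⟨
      (map f (left m (y ∷ ys)) , map f (right m (y ∷ ys))) ∎
    ... | no m≢y  = begin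
      splitAt (f m) (f y ∷ map f ys)
        ≡⟨ splitAt-there (map f ys) (m≢y ∘ f-injective) ⟩
      (f y ∷ left (f m) (map f ys) , right (f m) (map f ys))
        ≡⟨ cong (λ p → f y ∷ proj₁ p , proj₂ p) (splitAt-map m ys) ⟩
      (map f (y ∷ left m ys) , map f (right m ys))
        ≡⟨ cong (λ p → map f (proj₁ p) , map f (proj₂ p)) (splitAt-there ys m≢y) ⟨
      (map f (left m (y ∷ ys)) , map f (right m (y ∷ ys))) ∎

    sFuel-map : ∀ k xs → sFuel k (map f xs) ≡ map f (sFuel k xs)
    sFuel-map zero    xs       = refl
    sFuel-map (suc k) []       = refl
    sFuel-map (suc k) (y ∷ ys) = begin
      sFuel (suc k) ws
        ≡⟨ cong (λ m → sFuel k (left m ws) ++ sFuel k (right m ws) ++ [ m ]) (maxEntry-map (y ∷ ys)) ⟩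
      sFuel k (left (f M) ws) ++ sFuel k (right (f M) ws) ++ [ f M ]
        ≡⟨ cong (λ p → sFuel k (proj₁ p) ++ sFuel k (proj₂ p) ++ [ f M ]) (splitAt-map M (y ∷ ys)) ⟩
      sFuel k (map f L) ++ sFuel k (map f R) ++ [ f M ]
        ≡⟨ cong₂ (λ a b → a ++ b ++ [ f M ]) (sFuel-map k L) (sFuel-map k R) ⟩
      map f (sFuel k L) ++ map f (sFuel k R) ++ map f [ M ]
        ≡⟨ cong (map f (sFuel k L) ++_) (map-++ f (sFuel k R) [ M ]) ⟨
      map f (sFuel k L) ++ map f (sFuel k R ++ [ M ])
        ≡⟨ map-++ f (sFuel k L) _ ⟨
      map f (sFuel (suc k) (y ∷ ys)) ∎
      where
      ws = map f (y ∷ ys)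
      L = lhs (y ∷ ys)
      R = rhs (y ∷ ys)
      M = maxEntry (y ∷ ys)

    s-map : ∀ σ → s (map f σ) ≡ map f (s σ)
    s-map σ = trans (cong (λ l → sFuel l (map f σ)) (length-map f σ)) (sFuel-map (length σ) σ)

    -- f moves no entry into or out of the value 0, so every step of the
    -- search defining sd' sees the same answers.
    headIsZero-map : ∀ τ → headIsZero (map f τ) ≡ headIsZero τ
    headIsZero-map []           = refl
    headIsZero-map (zero ∷ ys)  = cong (_≡ᵇ 0) f-0
    headIsZero-map (suc y ∷ ys) = ≡ᵇ-false (λ fy≡0 → 1+n≢0 (f-injective (trans fy≡0 (sym f-0))))

    sdSearch-map : ∀ k t σ → sdSearch k t (map f σ) ≡ sdSearch k t σ
    sdSearch-map zero    t σ = refl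
    sdSearch-map (suc k) t σ
      with headIsZero (s (map f σ)) | headIsZero (s σ)
         | trans (cong headIsZero (s-map σ)) (headIsZero-map (s σ))
    ... | true  | .true  | refl = refl
    ... | false | .false | refl =
      trans (cong (sdSearch k (suc t)) (s-map σ)) (sdSearch-map k (suc t) (s σ))

    sd'-map : ∀ σ → sd' (map f σ) ≡ sd' σ
    sd'-map σ = begin
      sdSearch (suc (length (map f σ))) 1 (map f σ ++ [ 0 ])
        ≡⟨ cong₂ (λ l w → sdSearch (suc l) 1 w) (length-map f σ) map-snoc ⟩
      sdSearch (suc (length σ)) 1 (map f (σ ++ [ 0 ]))
        ≡⟨ sdSearch-map _ 1 (σ ++ [ 0 ]) ⟩
      sd' σ ∎
      where
      map-snoc : map f σ ++ [ 0 ] ≡ map f (σ ++ [ 0 ])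
      map-snoc = sym (trans (map-++ f σ [ 0 ]) (cong (λ z → map f σ ++ [ z ]) f-0))

  -- lift renames 1, 2, 3, … to 2, 3, 4, … and fixes 0, freeing the value 1.
  lift : ℕ → ℕ
  lift zero    = zero
  lift (suc k) = suc (suc k)

  lift-injective : ∀ {a b} → lift a ≡ lift b → a ≡ b
  lift-injective {zero}  {zero}  _    = refl
  lift-injective {suc a} {suc b} refl = refl

  lift-⊔ : ∀ a b → lift (a ⊔ b) ≡ lift a ⊔ lift b
  lift-⊔ zero    b       = refl
  lift-⊔ (suc a) zero    = refl
  lift-⊔ (suc a) (suc b) = refl

  sd'-lift : ∀ σ → sd' (map lift σ) ≡ sd' σ
  sd'-lift = Relabel.sd'-map lift refl lift-injective lift-⊔

  insertions-length : ∀ x τ → length (insertions x τ) ≡ suc (length τ)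
  insertions-length x []       = refl
  insertions-length x (y ∷ ys) =
    cong suc (trans (length-map (y ∷_) (insertions x ys)) (insertions-length x ys))

  insertions-lengths : ∀ x τ → All (λ π → length π ≡ suc (length τ)) (insertions x τ)
  insertions-lengths x []       = refl ∷ []
  insertions-lengths x (y ∷ ys) = refl ∷ All.map⁺ (All.map (cong suc) (insertions-lengths x ys))

  insertions-∋ : ∀ x τ → All (x ∈_) (insertions x τ)
  insertions-∋ x []       = here refl ∷ []
  insertions-∋ x (y ∷ ys) = here refl ∷ All.map⁺ (All.map there (insertions-∋ x ys))

  insertions-All : ∀ {P : ℕ → Set} x τ → P x → All P τ → All (All P) (insertions x τ)
  insertions-All x []       px []         = (px ∷ []) ∷ []
  insertions-All x (y ∷ ys) px (py ∷ pys) =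
    (px ∷ py ∷ pys) ∷ All.map⁺ (All.map (py ∷_) (insertions-All x ys px pys))

  remove-insertions : ∀ {x} τ → All (x ≢_) τ → All (λ π → remove x π ≡ τ) (insertions x τ)
  remove-insertions {x} []       []           = remove-here {x} [] refl ∷ []
  remove-insertions {x} (y ∷ ys) (x≢y ∷ x∉ys) =
    trans (remove-here {x} (y ∷ ys) refl) (remove-absent (x≢y ∷ x∉ys)) ∷
    All.map⁺ (All.map (λ {π} e → trans (remove-there π x≢y) (cong (y ∷_) e)) (remove-insertions ys x∉ys))

  map-insertions : ∀ (h : ℕ → ℕ) x τ → map (map h) (insertions x τ) ≡ insertions (h x) (map h τ)
  map-insertions h x []       = refl
  map-insertions h x (y ∷ ys) = cong ((h x ∷ h y ∷ map h ys) ∷_) (begin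
    map (map h) (map (y ∷_) (insertions x ys))  ≡⟨ map-∘ (insertions x ys) ⟨
    map (λ π → h y ∷ map h π) (insertions x ys) ≡⟨ map-∘ (insertions x ys) ⟩
    map (h y ∷_) (map (map h) (insertions x ys)) ≡⟨ cong (map (h y ∷_)) (map-insertions h x ys) ⟩
    map (h y ∷_) (insertions (h x) (map h ys))  ∎)

  concatMap-concatMap : ∀ {A B C : Set} (f : B → List C) (g : A → List B) xs →
                        concatMap f (concatMap g xs) ≡ concatMap (concatMap f ∘ g) xs
  concatMap-concatMap f g []       = refl
  concatMap-concatMap f g (x ∷ xs) =
    trans (concatMap-++ f (g x) (concatMap g xs)) (cong (concatMap f (g x) ++_) (concatMap-concatMap f g xs))

  concatMap-↭ : ∀ {A B : Set} (f : A → List B) {xs ys} → xs ↭ ys → concatMap f xs ↭ concatMap f ys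
  concatMap-↭ f ↭.refl          = ↭-refl
  concatMap-↭ f (↭.prep x p)    = ++⁺ˡ (f x) (concatMap-↭ f p)
  concatMap-↭ f (↭.swap x y p)  = ↭-trans (shifts (f x) (f y)) (++⁺ˡ (f y) (++⁺ˡ (f x) (concatMap-↭ f p)))
  concatMap-↭ f (↭.trans p q)   = ↭-trans (concatMap-↭ f p) (concatMap-↭ f q)

  concatMap-↭-pointwise : ∀ {A B : Set} (f g : A → List B) xs → (∀ x → f x ↭ g x) →
                          concatMap f xs ↭ concatMap g xs
  concatMap-↭-pointwise f g []       _   = ↭-refl
  concatMap-↭-pointwise f g (x ∷ xs) f↭g = ++⁺ (f↭g x) (concatMap-↭-pointwise f g xs f↭g)

  insertions-comm : ∀ a b τ → concatMap (insertions a) (insertions b τ) ↭ concatMap (insertions b) (insertions a τ)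
  insertions-comm a b []       = ↭.swap _ _ ↭-refl
  insertions-comm a b (y ∷ ys) = ↭-trans (layout a b) (↭-trans
    (↭.swap _ _ (++⁺ (++-comm (map (λ w → b ∷ y ∷ w) (insertions a ys)) _)
                     (map⁺ (y ∷_) (insertions-comm a b ys))))
    (↭-sym (layout b a)))
    where
    behind-y : ∀ a W → concatMap (λ w → insertions a (y ∷ w)) W ↭
               map (λ w → a ∷ y ∷ w) W ++ map (y ∷_) (concatMap (insertions a) W)
    behind-y a []      = ↭-refl
    behind-y a (w ∷ W) = ↭.prep (a ∷ y ∷ w) (↭-trans
      (++⁺ˡ (map (y ∷_) (insertions a w)) (behind-y a W))
      (↭-trans (shifts (map (y ∷_) (insertions a w)) (map (λ w → a ∷ y ∷ w) W))
        (++⁺ˡ (map (λ w → a ∷ y ∷ w) W) (↭-reflexive (sym (map-++ (y ∷_) (insertions a w) _))))))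
    -- Sorted by where a and b land relative to y.
    layout : ∀ a b → concatMap (insertions a) (insertions b (y ∷ ys)) ↭
      (a ∷ b ∷ y ∷ ys) ∷ (b ∷ a ∷ y ∷ ys) ∷
        ((map (λ w → b ∷ y ∷ w) (insertions a ys) ++ map (λ w → a ∷ y ∷ w) (insertions b ys))
         ++ map (y ∷_) (concatMap (insertions a) (insertions b ys)))
    layout a b = ↭.prep _ (↭.prep _ (↭-trans
      (++⁺ (↭-reflexive (sym (map-∘ (insertions a ys))))
           (↭-trans (↭-reflexive (concatMap-map (insertions a) (y ∷_) (insertions b ys)))
                    (behind-y a (insertions b ys))))
      (↭-reflexive (sym (++-assoc (map (λ w → b ∷ y ∷ w) (insertions a ys)) _ _)))))

  -- T n lists the elements of S_n grouped by deletion of the entry 1: for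
  -- every σ ∈ T n, relabelled by lift, all ways of inserting 1.
  T : ℕ → List (List ℕ)
  T zero    = [] ∷ []
  T (suc n) = concatMap (insertions 1 ∘ map lift) (T n)

  All-concatMap : ∀ {A B : Set} {P : B → Set} {Q : A → Set} (f : A → List B) {xs} →
                  (∀ {x} → Q x → All P (f x)) → All Q xs → All P (concatMap f xs)
  All-concatMap f h qs = All.concat⁺ (All.map⁺ (All.map h qs))

  lift-positive : ∀ {σ} → All (0 <_) σ → All (1 <_) (map lift σ)
  lift-positive pos = All.map⁺ (All.map (λ { {suc k} _ → s≤s (s≤s z≤n) }) pos)

  T-elements : ∀ n → All (λ σ → All (0 <_) σ × length σ ≡ n) (T n)
  T-elements zero    = ([] , refl) ∷ []
  T-elements (suc n) = All-concatMap (insertions 1 ∘ map lift) step (T-elements n)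
    where
    step : ∀ {σ} → All (0 <_) σ × length σ ≡ n →
           All (λ π → All (0 <_) π × length π ≡ suc n) (insertions 1 (map lift σ))
    step {σ} (pos , len) =
      All.zipWith (λ (pos′ , len′) → pos′ , trans len′ (cong suc (trans (length-map lift σ) len)))
      (insertions-All 1 _ (s≤s z≤n) (All.map (<-trans (s≤s z≤n)) (lift-positive pos)) ,
       insertions-lengths 1 _)

  length-concatMap : ∀ {A B : Set} (f : A → List B) {c} xs → All (λ x → length (f x) ≡ c) xs →
                     length (concatMap f xs) ≡ length xs * c
  length-concatMap f []       []       = refl
  length-concatMap f (x ∷ xs) (p ∷ ps) = trans (length-++ (f x)) (cong₂ _+_ p (length-concatMap f xs ps))

  T-length : ∀ n → length (T n) ≡ n !
  T-length zero    = refl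
  T-length (suc n) = begin
    length (T (suc n))  ≡⟨ length-concatMap _ (T n) (All.map count (T-elements n)) ⟩
    length (T n) * suc n ≡⟨ cong (_* suc n) (T-length n) ⟩
    n ! * suc n         ≡⟨ *-comm (n !) (suc n) ⟩
    suc n !             ∎
    where
    count : ∀ {σ} → All (0 <_) σ × length σ ≡ n → length (insertions 1 (map lift σ)) ≡ suc n
    count {σ} (_ , len) = trans (insertions-length 1 (map lift σ)) (cong suc (trans (length-map lift σ) len))

  T-insert-max : ∀ n → T (suc n) ↭ concatMap (insertions (suc n)) (T n)
  T-insert-max zero    = ↭-refl
  T-insert-max (suc n) =
    ↭-trans (concatMap-↭ F (T-insert-max n))
    (↭-trans (↭-reflexive (concatMap-concatMap F (insertions (suc n)) (T n)))
    (↭-trans (concatMap-↭-pointwise _ _ (T n) swap-order)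
             (↭-reflexive (sym (concatMap-concatMap (insertions (2 + n)) F (T n))))))
    where
    F : List ℕ → List (List ℕ)
    F = insertions 1 ∘ map lift
    -- Relabelling turns the insertion of n+1 into that of n+2, which commutes
    -- with the insertion of 1.
    swap-order : ∀ ρ → concatMap F (insertions (suc n) ρ) ↭ concatMap (insertions (2 + n)) (F ρ)
    swap-order ρ = ↭-trans
      (↭-reflexive (begin
        concatMap F (insertions (suc n) ρ)
          ≡⟨ concatMap-map (insertions 1) (map lift) (insertions (suc n) ρ) ⟨
        concatMap (insertions 1) (map (map lift) (insertions (suc n) ρ))
          ≡⟨ cong (concatMap (insertions 1)) (map-insertions lift (suc n) ρ) ⟩
        concatMap (insertions 1) (insertions (2 + n) (map lift ρ)) ∎))
      (insertions-comm 1 (2 + n) (map lift ρ))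

  S↭T : ∀ n → S n ↭ T n
  S↭T zero    = ↭-refl
  S↭T (suc n) = ↭-trans (concatMap-↭ (insertions (suc n)) (S↭T n)) (↭-sym (T-insert-max n))

  sum-map-mono : ∀ {A : Set} (F G : A → ℕ) {xs} → All (λ x → F x ≤ G x) xs → sum (map F xs) ≤ sum (map G xs)
  sum-map-mono F G []       = z≤n
  sum-map-mono F G (p ∷ ps) = +-mono-≤ p (sum-map-mono F G ps)

  sum-map-const : ∀ {A : Set} c (xs : List A) → sum (map (λ _ → c) xs) ≡ length xs * c
  sum-map-const c []       = refl
  sum-map-const c (x ∷ xs) = cong (c +_) (sum-map-const c xs)

  sum-map-concatMap : ∀ {A B : Set} (F : B → ℕ) (f : A → List B) xs →
                      sum (map F (concatMap f xs)) ≡ sum (map (λ x → sum (map F (f x))) xs)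
  sum-map-concatMap F f []       = refl
  sum-map-concatMap F f (x ∷ xs) = begin
    sum (map F (f x ++ concatMap f xs))              ≡⟨ cong sum (map-++ F (f x) (concatMap f xs)) ⟩
    sum (map F (f x) ++ map F (concatMap f xs))      ≡⟨ sum-++ (map F (f x)) _ ⟩
    sum (map F (f x)) + sum (map F (concatMap f xs)) ≡⟨ cong (sum (map F (f x)) +_) (sum-map-concatMap F f xs) ⟩
    sum (map (λ x → sum (map F (f x))) (x ∷ xs))     ∎

  sum-map-scale : ∀ {A : Set} c (F : A → ℕ) xs →
                  sum (map (λ x → c * suc (F x)) xs) ≡ c * (sum (map F xs) + length xs)
  sum-map-scale c F []       = sym (*-zeroʳ c)
  sum-map-scale c F (x ∷ xs) = begin
    c * suc (F x) + sum (map (λ x → c * suc (F x)) xs)   ≡⟨ cong (c * suc (F x) +_) (sum-map-scale c F xs) ⟩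
    c * suc (F x) + c * (sum (map F xs) + length xs)     ≡⟨ *-distribˡ-+ c (suc (F x)) _ ⟨
    c * (suc (F x) + (sum (map F xs) + length xs))       ≡⟨ cong (c *_) (regroup (F x) (sum (map F xs)) (length xs)) ⟩
    c * (F x + sum (map F xs) + suc (length xs))         ∎
    where
    regroup : ∀ a b l → suc a + (b + l) ≡ a + b + suc l
    regroup a b l = trans (cong suc (sym (+-assoc a b l))) (sym (+-suc (a + b) l))

  -- The n+1 insertions π of 1 into the relabelled σ ∈ S_n satisfy
  -- sd'(π) ≤ sd'(σ) + 1, by (★) and invariance under relabelling.
  insertions-sd' : ∀ σ → All (0 <_) σ → sum (map sd' (insertions 1 (map lift σ))) ≤ suc (length σ) * suc (sd' σ)
  insertions-sd' σ pos = ≤-trans (sum-map-mono sd' (λ _ → suc (sd' σ)) each) (≤-reflexive (begin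
    sum (map (λ _ → suc (sd' σ)) (insertions 1 τ))  ≡⟨ sum-map-const _ (insertions 1 τ) ⟩
    length (insertions 1 τ) * suc (sd' σ)
      ≡⟨ cong (_* suc (sd' σ)) (trans (insertions-length 1 τ) (cong suc (length-map lift σ))) ⟩
    suc (length σ) * suc (sd' σ)                     ∎))
    where
    τ = map lift σ
    positive : All (0 <_) τ
    positive = All.map (<-trans (s≤s z≤n)) (lift-positive pos)
    bound : ∀ {π} → (All (0 <_) π × 1 ∈ π) × remove 1 π ≡ τ → sd' π ≤ suc (sd' σ)
    bound {π} ((pos′ , 1∈π) , removed) = subst (λ d → sd' π ≤ suc d)
      (trans (cong sd' removed) (sd'-lift σ)) (sd'-remove-one π pos′ 1∈π)
    each : All (λ π → sd' π ≤ suc (sd' σ)) (insertions 1 τ)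
    each = All.map bound (All.zip (All.zip (insertions-All 1 τ (s≤s z≤n) positive , insertions-∋ 1 τ) ,
                                   remove-insertions τ (All.map <⇒≢ (lift-positive pos))))

  T-sum : ∀ n → sum (map sd' (T (suc n))) ≤ suc n * (sum (map sd' (T n)) + length (T n))
  T-sum n = ≤-trans (≤-reflexive (sum-map-concatMap sd' (insertions 1 ∘ map lift) (T n)))
    (≤-trans (sum-map-mono _ (λ σ → suc n * suc (sd' σ)) (All.map bound (T-elements n)))
             (≤-reflexive (sum-map-scale (suc n) sd' (T n))))
    where
    bound : ∀ {σ} → All (0 <_) σ × length σ ≡ n →
            sum (map sd' (insertions 1 (map lift σ))) ≤ suc n * suc (sd' σ)
    bound {σ} (pos , refl) = insertions-sd' σ pos

  sd'-sum-step : ∀ n → sum (map sd' (S (suc n))) ≤ suc n * (sum (map sd' (S n)) + n !)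
  sd'-sum-step n = subst₂ _≤_
    (sym (sum-↭ (map⁺ sd' (S↭T (suc n)))))
    (cong₂ (λ a b → suc n * (a + b)) (sym (sum-↭ (map⁺ sd' (S↭T n)))) (T-length n))
    (T-sum n)

module FractionBound where

  open import Data.Nat as ℕ using (suc; NonZero)
  import Data.Nat.Properties as ℕ
  open import Data.Nat.Tactic.RingSolver using (solve-∀)
  open import Data.Integer as ℤ using (+_)
  import Data.Integer.Properties as ℤ
  open import Data.Rational using (_≤_; _+_; 1ℚ; _/_; toℚᵘ)
  open import Data.Rational.Properties using (toℚᵘ-cancel-≤; toℚᵘ-homo-+; toℚᵘ-fromℚᵘ)
  import Data.Rational.Unnormalised as ℚᵘ
  import Data.Rational.Unnormalised.Properties as ℚᵘ
  open import Relation.Binary.PropositionalEquality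
  open ≡-Reasoning

  toℚᵘ-/ : ∀ a d .{{_ : NonZero d}} → toℚᵘ ((+ a) / d) ℚᵘ.≃ (+ a) ℚᵘ./ d
  toℚᵘ-/ a (suc k) = toℚᵘ-fromℚᵘ (ℚᵘ.mkℚᵘ (+ a) k)

  -- The bound in ℚᵘ, by cross-multiplication: A·d ≤ (B + d)·(c·d).
  fraction-bound-ℚᵘ : ∀ A B c k → A ℕ.≤ suc c ℕ.* (B ℕ.+ suc k) →
                      (+ A) ℚᵘ./ (suc c ℕ.* suc k) ℚᵘ.≤ (+ B) ℚᵘ./ suc k ℚᵘ.+ ℚᵘ.1ℚᵘ
  fraction-bound-ℚᵘ A B c k h = ℚᵘ.*≤* (subst₂ ℤ._≤_ (ℤ.pos-* A (d ℕ.* 1)) numerator (ℤ.+≤+ cross))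
    where
    d = suc k
    regroup : ∀ c B d → c ℕ.* (B ℕ.+ d) ℕ.* (d ℕ.* 1) ≡ (B ℕ.+ d) ℕ.* (c ℕ.* d)
    regroup = solve-∀
    -- The hypothesis multiplied by the denominator d·1 of B/d + 1.
    cross : A ℕ.* (d ℕ.* 1) ℕ.≤ (B ℕ.+ d) ℕ.* (suc c ℕ.* d)
    cross = ℕ.≤-trans (ℕ.*-monoˡ-≤ (d ℕ.* 1) h) (ℕ.≤-reflexive (regroup (suc c) B d))
    -- B/d + 1 has numerator B·1 + 1·d = B + d.
    numerator : + ((B ℕ.+ d) ℕ.* (suc c ℕ.* d)) ≡ (+ B ℤ.* + 1 ℤ.+ + 1 ℤ.* + d) ℤ.* + (suc c ℕ.* d)
    numerator = begin
      + ((B ℕ.+ d) ℕ.* (suc c ℕ.* d))                ≡⟨ ℤ.pos-* (B ℕ.+ d) (suc c ℕ.* d) ⟩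
      + (B ℕ.+ d) ℤ.* + (suc c ℕ.* d)                ≡⟨ cong (ℤ._* + (suc c ℕ.* d)) (ℤ.pos-+ B d) ⟩
      (+ B ℤ.+ + d) ℤ.* + (suc c ℕ.* d)
        ≡⟨ cong (ℤ._* + (suc c ℕ.* d)) (cong₂ ℤ._+_ (ℤ.*-identityʳ (+ B)) (ℤ.*-identityˡ (+ d))) ⟨
      (+ B ℤ.* + 1 ℤ.+ + 1 ℤ.* + d) ℤ.* + (suc c ℕ.* d) ∎

  fraction-bound : ∀ A B c d .{{_ : NonZero d}} .{{_ : NonZero (suc c ℕ.* d)}} →
                   A ℕ.≤ suc c ℕ.* (B ℕ.+ d) → (+ A) / (suc c ℕ.* d) ≤ (+ B) / d + 1ℚ
  fraction-bound A B c (suc k) h = toℚᵘ-cancel-≤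
    (ℚᵘ.≤-respʳ-≃ (ℚᵘ.≃-sym sum≃)
      (ℚᵘ.≤-respˡ-≃ (ℚᵘ.≃-sym (toℚᵘ-/ A _)) (fraction-bound-ℚᵘ A B c k h)))
    where
    sum≃ : toℚᵘ ((+ B) / suc k + 1ℚ) ℚᵘ.≃ (+ B) ℚᵘ./ suc k ℚᵘ.+ ℚᵘ.1ℚᵘ
    sum≃ = ℚᵘ.≃-trans (toℚᵘ-homo-+ ((+ B) / suc k) 1ℚ) (ℚᵘ.+-cong (toℚᵘ-/ B (suc k)) (toℚᵘ-/ 1 1))

open import Defs
open import Data.Nat using (ℕ; suc)
import Data.Nat as ℕ
open import Data.Rational using (_≤_; _+_; 1ℚ)
open import Data.Nat.Properties using (_!≢0)
open SortingDepth using (sd'-sum-step)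
open FractionBound using (fraction-bound)

-- D'_{n+1} = Σ_{S_{n+1}} sd' / ((n+1)·n!) and D'_n = Σ_{S_n} sd' / n!, so
-- the sum bound is exactly the hypothesis of fraction-bound.
lemma2p8 : (n : ℕ) → 1 ℕ.≤ n → D' (suc n) ≤ D' n + 1ℚ
lemma2p8 n _ = fraction-bound _ _ n (n ℕ.!) {{n !≢0}} {{suc n !≢0}} (sd'-sum-step n)
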